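{- Let $n\ge 1$, $A\subseteq\{1,\dots,n\}$ nonempty, and let $\mathbf p$ be any position of $SN(n,A)$ with $p_n=\max_i p_i$. Then $r(\mathbf p)=\mathrm{ctt}(\mathbf p,m)$, where $m$ is the largest integer with $0\le m\le p_n$ for which $\mathrm{ctt}(\mathbf p,m)$ is reduced.
   Context: The game $SN(n,A)$ is played on $n$ stacks of tokens; a position is $\mathbf p=(p_1,\dots,p_n)$ of nonnegative integers. A move consists of choosing some $\ell\in A$ and $\ell$ distinct stacks, each of height at least $1$, and removing exactly one token from each. A terminal position is one with no legal move. For a position $\mathbf p$, let $\mathcal T(\mathbf p)$ be the set of terminal positions reachable from $\mathbf p$ by finite sequences of legal moves, $u_i(\mathbf p)=\min\{t_i:\mathbf t\in\mathcal T(\mathbf p)\}$, $r(\mathbf p)=\mathbf p-u(\mathbf p)$; $\mathbf p$ is reduced if $r(\mathbf p)=\mathbf p$. The "chop the top" function is $\mathrm{ctt}(\mathbf p,m)_i=\min\{p_i,m\}$ for $i=1,\dots,n$. -}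

module Defs where

open import Data.Nat using (ℕ; zero; suc; _≤_; _<_; _∸_; _⊓_)
open import Data.Bool using (true; false)
open import Data.Fin using (Fin)
open import Data.Fin.Subset using (Subset; _∈_; ∣_∣)
open import Data.Vec using (lookup)
open import Data.Product using (Σ; _×_; ∃)
open import Relation.Nullary using (¬_)
open import Relation.Binary.PropositionalEquality using (_≡_)
open import Relation.Binary.Construct.Closure.ReflexiveTransitive using (Star)

-- A position of SN(n,A): the heights of the n stacks.
Position : ℕ → Set
Position n = Fin n → ℕ

removeFrom : ∀ {n} → Position n → Subset n → Position n
removeFrom p S i with lookup S i
... | true  = p i ∸ 1
... | false = p i

-- A legal move of SN(n,A) from p to q: choose a set S of ℓ = |S| ∈ A
-- distinct stacks, each of height ≥ 1, and remove one token from each.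
-- The game set A ⊆ {1,…,n} is given as a predicate on ℕ.
record Move {n : ℕ} (A : ℕ → Set) (p q : Position n) : Set where
  constructor move
  field
    stacks   : Subset n
    sizeInA  : A ∣ stacks ∣
    nonEmpty : ∀ i → i ∈ stacks → 1 ≤ p i
    result   : ∀ i → q i ≡ removeFrom p stacks i

Reachable : ∀ {n} (A : ℕ → Set) → Position n → Position n → Set
Reachable A = Star (Move A)

Terminal : ∀ {n} (A : ℕ → Set) → Position n → Set
Terminal A p = ¬ (∃ λ q → Move A p q)

InT : ∀ {n} (A : ℕ → Set) → Position n → Position n → Set
InT A p t = Reachable A p t × Terminal A t

-- u is u(p): u i = min { t i : t ∈ 𝒯(p) } for every i (attained and a lower bound).
IsU : ∀ {n} (A : ℕ → Set) → Position n → Position n → Set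
IsU A p u = ∀ i → (Σ _ λ t → InT A p t × t i ≡ u i)
                × (∀ t → InT A p t → u i ≤ t i)

-- r(p) = p − u(p); IsR A p r means r = r(p).
IsR : ∀ {n} (A : ℕ → Set) → Position n → Position n → Set
IsR A p r = Σ _ λ u → IsU A p u × (∀ i → r i ≡ p i ∸ u i)

Reduced : ∀ {n} (A : ℕ → Set) → Position n → Set
Reduced A p = IsR A p p

ctt : ∀ {n} → Position n → ℕ → Position n
ctt p m i = p i ⊓ m

module Submission where

-- A position y is reachable from x iff y = x ∸ removals L for a list L of
-- legal stack sets with removals L ≤ x: only the number of hits on each stack
-- matters.  If some play from p removed more than m tokens from a stack, let j
-- be the stack it hits most, say h > m times.  In ctt p h, stack j is highest
-- and is emptied by that play; trading hits on j for hits on another stack i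
-- empties i instead, so ctt p h is reduced, contradicting the choice of m.
-- Hence u(p) ≥ p ∸ m.  Conversely, a play emptying stack i of ctt p m,
-- replayed from p, leaves stack i at p i ∸ m in a terminal position: a further
-- move would hit a stack that the play emptied, and push it below p ∸ m.

open import Data.Bool using (Bool; true; false)
open import Data.Fin as Fin using (Fin; fromℕ)
import Data.Fin.Properties as Fin
open import Data.Fin.Subset using (Subset; _∈_; ∣_∣; Nonempty)
open import Data.Fin.Subset.Properties using (nonempty?; Empty-unique; ∣⊥∣≡0)
open import Data.List using (List; []; _∷_; allFin)
open import Data.List.Extrema.Nat using (argmax; f[xs]≤f[argmax])
open import Data.List.Membership.Propositional.Properties using (∈-allFin)
import Data.List.Relation.Unary.All as All
open import Data.Nat using (ℕ; zero; suc; _+_; _≤_; _<_; _∸_; _⊓_; _⊔_; z≤n; s≤s; s≤s⁻¹; _≟_)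
open import Data.Nat.Properties
open import Algebra.Properties.CommutativeSemigroup +-commutativeSemigroup using (x∙yz≈y∙xz)
open import Data.Product using (Σ; ∃; _×_; _,_; proj₁)
open import Data.Vec using (_∷_; lookup; _[_]≔_)
open import Data.Vec.Functional using (foldr)
open import Data.Vec.Properties using (lookup∘update; lookup∘update′; []=⇒lookup; lookup⇒[]=)
open import Defs
open import Function using (_∘_)
open import Relation.Binary.Construct.Closure.ReflexiveTransitive using (ε; _◅_; _◅◅_)
open import Relation.Binary.PropositionalEquality
open import Relation.Nullary using (¬_; yes; no)
open import Relation.Nullary.Negation using (¬¬-map; contradiction)

m∸[m⊓n]≡m∸n : ∀ m n → m ∸ (m ⊓ n) ≡ m ∸ n
m∸[m⊓n]≡m∸n m n = trans (∸-distribˡ-⊓-⊔ m m n) (cong (_⊔ (m ∸ n)) (n∸n≡0 m))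

m⊓n≡m∸[m∸n] : ∀ m n → m ⊓ n ≡ m ∸ (m ∸ n)
m⊓n≡m∸[m∸n] m n = trans (sym (m∸[m∸n]≡n (m⊓n≤m m n))) (cong (m ∸_) (m∸[m⊓n]≡m∸n m n))

m≡m∸n⇒n≡0 : ∀ {m n} → n ≤ m → m ≡ m ∸ n → n ≡ 0
m≡m∸n⇒n≡0 {m} {n} n≤m m≡m∸n = begin
  n             ≡⟨ sym (m∸[m∸n]≡n n≤m) ⟩
  m ∸ (m ∸ n)   ≡⟨ cong (m ∸_) (sym m≡m∸n) ⟩
  m ∸ m         ≡⟨ n∸n≡0 m ⟩
  0             ∎
  where open ≡-Reasoning

¬¬-∀-Fin : ∀ {n} {P : Fin n → Set} → (∀ i → ¬ ¬ P i) → ¬ ¬ (∀ i → P i)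
¬¬-∀-Fin {zero}      _   ¬∀ = ¬∀ λ ()
¬¬-∀-Fin {suc n} {P} ¬¬P ¬∀ = ¬¬P Fin.zero λ P0 →
  ¬¬-∀-Fin {P = P ∘ Fin.suc} (¬¬P ∘ Fin.suc) λ P+ →
  ¬∀ λ { Fin.zero → P0 ; (Fin.suc i) → P+ i }

∣p∣>0⇒Nonempty : ∀ {n} (S : Subset n) → 1 ≤ ∣ S ∣ → Nonempty S
∣p∣>0⇒Nonempty {n} S 1≤∣S∣ with nonempty? S
... | yes S≠∅ = S≠∅
... | no  S=∅ = contradiction (trans (cong ∣_∣ (Empty-unique S=∅)) (∣⊥∣≡0 n)) (>⇒≢ 1≤∣S∣)

replace : ∀ {n} → Subset n → Fin n → Fin n → Subset n
replace S j i = (S [ j ]≔ false) [ i ]≔ true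

∣S[i]≔true∣ : ∀ {n} (S : Subset n) i → lookup S i ≡ false → ∣ S [ i ]≔ true ∣ ≡ suc ∣ S ∣
∣S[i]≔true∣ (true  ∷ S) Fin.zero    ()
∣S[i]≔true∣ (false ∷ S) Fin.zero    _ = refl
∣S[i]≔true∣ (true  ∷ S) (Fin.suc i) i∉S = cong suc (∣S[i]≔true∣ S i i∉S)
∣S[i]≔true∣ (false ∷ S) (Fin.suc i) i∉S = ∣S[i]≔true∣ S i i∉S

∣S[i]≔false∣ : ∀ {n} (S : Subset n) i → lookup S i ≡ true → suc ∣ S [ i ]≔ false ∣ ≡ ∣ S ∣
∣S[i]≔false∣ (true  ∷ S) Fin.zero    _ = refl
∣S[i]≔false∣ (false ∷ S) Fin.zero    ()
∣S[i]≔false∣ (true  ∷ S) (Fin.suc i) i∈S = cong suc (∣S[i]≔false∣ S i i∈S)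
∣S[i]≔false∣ (false ∷ S) (Fin.suc i) i∈S = ∣S[i]≔false∣ S i i∈S

module _ {n} (S : Subset n) {i j : Fin n} (i∉S : lookup S i ≡ false) (j∈S : lookup S j ≡ true) where

  private
    i≢j : i ≢ j
    i≢j refl = contradiction (trans (sym i∉S) j∈S) λ ()

  ∣replace∣ : ∣ replace S j i ∣ ≡ ∣ S ∣
  ∣replace∣ = trans (∣S[i]≔true∣ (S [ j ]≔ false) i (trans (lookup∘update′ i≢j S false) i∉S))
                    (∣S[i]≔false∣ S j j∈S)

  replace-∋-new : lookup (replace S j i) i ≡ true
  replace-∋-new = lookup∘update i (S [ j ]≔ false) true

  replace-∌-old : lookup (replace S j i) j ≡ false
  replace-∌-old = trans (lookup∘update′ (i≢j ∘ sym) (S [ j ]≔ false) true) (lookup∘update j S false)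

  replace-others : ∀ l → l ≢ i → l ≢ j → lookup (replace S j i) l ≡ lookup S l
  replace-others l l≢i l≢j = trans (lookup∘update′ l≢i (S [ j ]≔ false) true) (lookup∘update′ l≢j S false)

indicator : Bool → ℕ
indicator true  = 1
indicator false = 0

removeFrom-∸ : ∀ {n} (p : Position n) S i → removeFrom p S i ≡ p i ∸ indicator (lookup S i)
removeFrom-∸ p S i with lookup S i
... | true  = refl
... | false = refl

tokens : ∀ {n} → Position n → ℕ
tokens {n} = foldr _+_ 0 {n}

tokens-mono-≤ : ∀ {n} {x y : Position n} → (∀ i → x i ≤ y i) → tokens x ≤ tokens y
tokens-mono-≤ {zero}  _   = z≤n
tokens-mono-≤ {suc n} x≤y = +-mono-≤ (x≤y Fin.zero) (tokens-mono-≤ (x≤y ∘ Fin.suc))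

tokens-mono-< : ∀ {n} {x y : Position n} → (∀ i → x i ≤ y i) → ∀ j → x j < y j → tokens x < tokens y
tokens-mono-< {suc n} x≤y Fin.zero    x<y = +-mono-<-≤ x<y (tokens-mono-≤ (x≤y ∘ Fin.suc))
tokens-mono-< {suc n} x≤y (Fin.suc j) x<y =
  +-mono-≤-< (x≤y Fin.zero) (tokens-mono-< (x≤y ∘ Fin.suc) j x<y)

LegalSet : (ℕ → Set) → ℕ → Set
LegalSet A n = Σ (Subset n) λ S → A ∣ S ∣

module _ (A : ℕ → Set) {n : ℕ} where

  removals : List (LegalSet A n) → Position n
  removals []            i = 0
  removals ((S , _) ∷ L) i = indicator (lookup S i) + removals L i

  Emptiable : Position n → Fin n → Set
  Emptiable c i = ∃ λ t → InT A c t × t i ≡ 0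

  move⇒≤ : ∀ {x q : Position n} → Move A x q → ∀ i → q i ≤ x i
  move⇒≤ {x} (move S _ _ result) i =
    subst (_≤ x i) (sym (trans (result i) (removeFrom-∸ x S i))) (m∸n≤m (x i) (indicator (lookup S i)))

  move⇒< : ∀ {x q : Position n} (x→q : Move A x q) → ∀ {i} → i ∈ Move.stacks x→q → q i < x i
  move⇒< {x} {q} (move S _ nonEmpty result) {i} i∈S = begin-strict
    q i                          ≡⟨ trans (result i) (removeFrom-∸ x S i) ⟩
    x i ∸ indicator (lookup S i) ≡⟨ cong (λ b → x i ∸ indicator b) ([]=⇒lookup i∈S) ⟩
    x i ∸ 1                      <⟨ ∸-monoʳ-< {o = 0} (s≤s z≤n) (nonEmpty i i∈S) ⟩
    x i                          ∎
    where open ≤-Reasoning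

  reachable⇒≤ : ∀ {x y : Position n} → Reachable A x y → ∀ i → y i ≤ x i
  reachable⇒≤ ε         i = ≤-refl
  reachable⇒≤ (x→q ◅ r) i = ≤-trans (reachable⇒≤ r i) (move⇒≤ x→q i)

  indicator≤ : ∀ {x : Position n} S → (∀ i → i ∈ S → 1 ≤ x i) → ∀ i → indicator (lookup S i) ≤ x i
  indicator≤ S nonEmpty i with lookup S i in i∈S
  ... | true  = nonEmpty i (lookup⇒[]= i S i∈S)
  ... | false = z≤n

  reachable⇒schedule : ∀ {x y : Position n} → Reachable A x y →
                       Σ (List (LegalSet A n)) λ L → ∀ i → x i ≡ removals L i + y i
  reachable⇒schedule ε = [] , λ _ → refl
  reachable⇒schedule {x} {y} (move S a nonEmpty result ◅ q↝y) with reachable⇒schedule q↝y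
  ... | L , q≡ = (S , a) ∷ L , λ i → let b = indicator (lookup S i) in begin
    x i                      ≡⟨ sym (m+[n∸m]≡n (indicator≤ S nonEmpty i)) ⟩
    b + (x i ∸ b)            ≡⟨ cong (b +_) (trans (sym (trans (result i) (removeFrom-∸ x S i))) (q≡ i)) ⟩
    b + (removals L i + y i) ≡⟨ sym (+-assoc b (removals L i) (y i)) ⟩
    b + removals L i + y i   ∎
    where open ≡-Reasoning

  schedule⇒reachable : ∀ L (x : Position n) → (∀ i → removals L i ≤ x i) →
                       Σ (Position n) λ y → Reachable A x y × (∀ i → y i ≡ x i ∸ removals L i)
  schedule⇒reachable []            x _   = x , ε , λ _ → refl
  schedule⇒reachable ((S , a) ∷ L) x L≤x with schedule⇒reachable L (removeFrom x S) L≤x′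
    where
    L≤x′ : ∀ i → removals L i ≤ removeFrom x S i
    L≤x′ i = subst (removals L i ≤_) (sym (removeFrom-∸ x S i))
                   (m+n≤o⇒m≤o∸n (removals L i) (subst (_≤ x i) (+-comm _ (removals L i)) (L≤x i)))
  ... | y , x′↝y , y≡ = y , move S a nonEmpty (λ _ → refl) ◅ x′↝y , λ i →
        trans (y≡ i) (trans (cong (_∸ removals L i) (removeFrom-∸ x S i))
                            (∸-+-assoc (x i) (indicator (lookup S i)) (removals L i)))
    where
    nonEmpty : ∀ i → i ∈ S → 1 ≤ x i
    nonEmpty i i∈S =
      ≤-trans (subst (λ b → 1 ≤ indicator b + removals L i) (sym ([]=⇒lookup i∈S)) (s≤s z≤n)) (L≤x i)

  reduced⇒emptiable : ∀ {c : Position n} → Reduced A c → ∀ i → Emptiable c i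
  reduced⇒emptiable {c} (u , isU , c≡c∸u) i with isU i
  ... | (t , inT@(c↝t , _) , tᵢ≡uᵢ) , _ =
    t , inT , trans tᵢ≡uᵢ (m≡m∸n⇒n≡0 (subst (_≤ c i) tᵢ≡uᵢ (reachable⇒≤ c↝t i)) (c≡c∸u i))

  emptiable⇒reduced : ∀ {c : Position n} → (∀ i → Emptiable c i) → Reduced A c
  emptiable⇒reduced emptiable = (λ _ → 0) , (λ i → emptiable i , λ _ _ → z≤n) , λ _ → refl

  replay : ∀ {c t : Position n} → Reachable A c t → ∀ {x : Position n} → (∀ l → c l ≤ x l) →
           ∃ λ g → Reachable A x g × (∀ l → g l + c l ≡ x l + t l)
  replay {c} {t} c↝t {x} c≤x with reachable⇒schedule c↝t
  ... | L , c≡ = let g , x↝g , g≡ = schedule⇒reachable L x L≤x in g , x↝g , λ l → begin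
    g l + c l                                 ≡⟨ cong₂ _+_ (g≡ l) (c≡ l) ⟩
    x l ∸ removals L l + (removals L l + t l) ≡⟨ sym (+-assoc (x l ∸ removals L l) _ _) ⟩
    x l ∸ removals L l + removals L l + t l   ≡⟨ cong (_+ t l) (m∸n+n≡m (L≤x l)) ⟩
    x l + t l                                 ∎
    where
    open ≡-Reasoning
    L≤x : ∀ l → removals L l ≤ x l
    L≤x l = ≤-trans (subst (removals L l ≤_) (sym (c≡ l)) (m≤m+n _ _)) (c≤x l)

module _ (A : ℕ → Set) {n : ℕ} (i j : Fin n) where

  record Transfer (L : List (LegalSet A n)) (k : ℕ) : Set where
    field
      schedule : List (LegalSet A n)
      gain     : removals A schedule i ≡ k + removals A L i
      loss     : k + removals A schedule j ≡ removals A L j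
      others   : ∀ l → l ≢ i → l ≢ j → removals A schedule l ≡ removals A L l

  noTransfer : ∀ L → Transfer L 0
  noTransfer L = record { schedule = L ; gain = refl ; loss = refl ; others = λ _ _ _ → refl }

  keepHead : ∀ {L k} s → Transfer L k → Transfer (s ∷ L) k
  keepHead {L} {k} (S , a) τ = record
    { schedule = (S , a) ∷ schedule
    ; gain     = trans (cong (bᵢ +_) gain) (x∙yz≈y∙xz bᵢ k (removals A L i))
    ; loss     = trans (x∙yz≈y∙xz k bⱼ (removals A schedule j)) (cong (bⱼ +_) loss)
    ; others   = λ l l≢i l≢j → cong (indicator (lookup S l) +_) (others l l≢i l≢j)
    }
    where
    open Transfer τ
    bᵢ = indicator (lookup S i)
    bⱼ = indicator (lookup S j)

  exchangeHead : ∀ {L k} S a → lookup S i ≡ false → lookup S j ≡ true →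
                 Transfer L k → Transfer ((S , a) ∷ L) (suc k)
  exchangeHead {L} {k} S a i∉S j∈S τ = record
    { schedule = (replace S j i , subst A (sym (∣replace∣ S i∉S j∈S)) a) ∷ schedule
    ; gain     = trans (cong (λ b → indicator b + removals A schedule i) (replace-∋-new S i∉S j∈S))
                       (trans (cong suc gain) (cong (λ b → suc k + (indicator b + removals A L i)) (sym i∉S)))
    ; loss     = trans (cong (λ b → suc k + (indicator b + removals A schedule j)) (replace-∌-old S i∉S j∈S))
                       (trans (cong suc loss) (cong (λ b → indicator b + removals A L j) (sym j∈S)))
    ; others   = λ l l≢i l≢j →
        trans (cong (λ b → indicator b + removals A schedule l) (replace-others S i∉S j∈S l l≢i l≢j))
              (cong (indicator (lookup S l) +_) (others l l≢i l≢j))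
    }
    where open Transfer τ

  -- Each set containing j but not i can trade j for i, and there are at least
  -- removals j ∸ removals i of them.
  transfer : ∀ L k → k + removals A L i ≤ removals A L j → Transfer L k
  transfer L             zero    _ = noTransfer L
  transfer []            (suc k) ()
  transfer ((S , a) ∷ L) (suc k) k+rᵢ≤rⱼ with lookup S i in i∈S? | lookup S j in j∈S?
  ... | false | true  = exchangeHead S a i∈S? j∈S? (transfer L k (s≤s⁻¹ k+rᵢ≤rⱼ))
  ... | false | false = keepHead (S , a) (transfer L (suc k) k+rᵢ≤rⱼ)
  ... | true  | true  = keepHead (S , a) (transfer L (suc k)
        (s≤s⁻¹ (subst (_≤ suc (removals A L j)) (+-suc (suc k) (removals A L i)) k+rᵢ≤rⱼ)))
  ... | true  | false = keepHead (S , a) (transfer L (suc k)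
        (≤-trans (+-monoʳ-≤ (suc k) (n≤1+n (removals A L i))) k+rᵢ≤rⱼ))

module _ (A : ℕ → Set) (positive : ∀ ℓ → A ℓ → 1 ≤ ℓ) {n : ℕ} where

  move⇒tokens< : ∀ {x q : Position n} → Move A x q → tokens q < tokens x
  move⇒tokens< x→q@(move S a _ _) with ∣p∣>0⇒Nonempty S (positive _ a)
  ... | i , i∈S = tokens-mono-< (move⇒≤ A x→q) i (move⇒< A x→q i∈S)

  -- Having a move is undecidable for an arbitrary A, so a terminal position
  -- is only reached up to double negation.
  reachesTerminalWithin : ∀ N (x : Position n) → tokens x < N → ¬ ¬ (∃ λ t → InT A x t)
  reachesTerminalWithin (suc N) x x<N noTerminal = noTerminal (x , ε , λ (q , x→q) →
    reachesTerminalWithin N q (<-≤-trans (move⇒tokens< x→q) (s≤s⁻¹ x<N))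
      λ (t , q↝t , t-terminal) → noTerminal (t , x→q ◅ q↝t , t-terminal))

  reachesTerminal : ∀ (x : Position n) → ¬ ¬ (∃ λ t → InT A x t)
  reachesTerminal x = reachesTerminalWithin (suc (tokens x)) x ≤-refl

  schedule⇒¬¬emptiable : ∀ {c : Position n} L i → (∀ l → removals A L l ≤ c l) →
                         removals A L i ≡ c i → ¬ ¬ Emptiable A c i
  schedule⇒¬¬emptiable {c} L i L≤c Lᵢ≡cᵢ with schedule⇒reachable A L c L≤c
  ... | y , c↝y , y≡ =
    ¬¬-map (λ (t , y↝t , t-terminal) → t , (c↝y ◅◅ y↝t , t-terminal) , n≤0⇒n≡0 (tᵢ≤0 y↝t))
           (reachesTerminal y)
    where
    tᵢ≤0 : ∀ {t} → Reachable A y t → t i ≤ 0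
    tᵢ≤0 {t} y↝t = begin
      t i                  ≤⟨ reachable⇒≤ A y↝t i ⟩
      y i                  ≡⟨ y≡ i ⟩
      c i ∸ removals A L i ≡⟨ cong (c i ∸_) Lᵢ≡cᵢ ⟩
      c i ∸ c i            ≡⟨ n∸n≡0 (c i) ⟩
      0                    ∎
      where open ≤-Reasoning

  -- To empty stack i, trade removals from the highest stack j for removals from i.
  emptiesHighest⇒¬¬reduced : ∀ (c : Position n) L j → (∀ l → removals A L l ≤ c l) →
                             (∀ l → c l ≤ c j) → removals A L j ≡ c j → ¬ ¬ Reduced A c
  emptiesHighest⇒¬¬reduced c L j L≤c c≤cⱼ Lⱼ≡cⱼ = ¬¬-map (emptiable⇒reduced A) (¬¬-∀-Fin emptiable)
    where
    emptiable : ∀ i → ¬ ¬ Emptiable A c i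
    emptiable i = schedule⇒¬¬emptiable schedule i transferred≤c (transferred≡c i refl)
      where
      k : ℕ
      k = c i ∸ removals A L i
      k+Lᵢ≡cᵢ : k + removals A L i ≡ c i
      k+Lᵢ≡cᵢ = m∸n+n≡m (L≤c i)
      open Transfer (transfer A i j L k
                       (subst (_≤ removals A L j) (sym k+Lᵢ≡cᵢ) (subst (c i ≤_) (sym Lⱼ≡cⱼ) (c≤cⱼ i))))
      transferred≡c : ∀ l → l ≡ i → removals A schedule l ≡ c l
      transferred≡c l refl = trans gain k+Lᵢ≡cᵢ
      transferred≤c : ∀ l → removals A schedule l ≤ c l
      transferred≤c l with l Fin.≟ i | l Fin.≟ j
      ... | yes l≡i | _        = ≤-reflexive (transferred≡c l l≡i)
      ... | no _    | yes refl = ≤-trans (m≤n+m _ k) (≤-trans (≤-reflexive loss) (L≤c l))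
      ... | no l≢i  | no l≢j   = subst (_≤ c l) (sym (others l l≢i l≢j)) (L≤c l)

module ChopAtMaximalReduced (A : ℕ → Set) (positive : ∀ ℓ → A ℓ → 1 ≤ ℓ)
  {n : ℕ} (p : Position n) {top : ℕ} (p≤top : ∀ i → p i ≤ top) {m : ℕ}
  (maximal : ∀ m′ → m < m′ → m′ ≤ top → ¬ Reduced A (ctt p m′)) where

  removals≤m : ∀ L → (∀ i → removals A L i ≤ p i) → ∀ i → removals A L i ≤ m
  removals≤m L L≤p i = ≤-trans (≤h i) (≮⇒≥ λ m<h →
    emptiesHighest⇒¬¬reduced A positive (ctt p h) L j L≤c c≤cⱼ (sym cⱼ≡h)
      (maximal h m<h (≤-trans (L≤p j) (p≤top j))))
    where
    j = argmax (removals A L) i (allFin n)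
    h = removals A L j
    ≤h : ∀ l → removals A L l ≤ h
    ≤h l = All.lookup (f[xs]≤f[argmax] i (allFin n)) (∈-allFin l)
    cⱼ≡h : ctt p h j ≡ h
    cⱼ≡h = m≥n⇒m⊓n≡n (L≤p j)
    L≤c : ∀ l → removals A L l ≤ ctt p h l
    L≤c l = ⊓-glb (L≤p l) (≤h l)
    c≤cⱼ : ∀ l → ctt p h l ≤ ctt p h j
    c≤cⱼ l = ≤-trans (m⊓n≤n (p l) h) (≤-reflexive (sym cⱼ≡h))

  reachable⇒≥ : ∀ {f} → Reachable A p f → ∀ i → p i ∸ m ≤ f i
  reachable⇒≥ {f} p↝f i with reachable⇒schedule A p↝f
  ... | L , p≡ = begin
    p i ∸ m                               ≤⟨ ∸-monoʳ-≤ (p i) (removals≤m L L≤p i) ⟩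
    p i ∸ removals A L i                  ≡⟨ cong (_∸ removals A L i) (p≡ i) ⟩
    removals A L i + f i ∸ removals A L i ≡⟨ m+n∸m≡n (removals A L i) (f i) ⟩
    f i                                   ∎
    where
    open ≤-Reasoning
    L≤p : ∀ l → removals A L l ≤ p l
    L≤p l = subst (removals A L l ≤_) (sym (p≡ l)) (m≤m+n _ _)

  reduced⇒attained : Reduced A (ctt p m) → ∀ i → ∃ λ g → InT A p g × g i ≡ p i ∸ m
  reduced⇒attained reduced i with reduced⇒emptiable A reduced i
  ... | t , (c↝t , t-terminal) , tᵢ≡0 with replay A c↝t (λ l → m⊓n≤m (p l) m)
  ... | g , p↝g , g+c≡p+t = g , (p↝g , g-terminal) , g-at i tᵢ≡0
    where
    g-at : ∀ l → t l ≡ 0 → g l ≡ p l ∸ m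
    g-at l tₗ≡0 = begin
      g l                             ≡⟨ sym (m+n∸n≡m (g l) (p l ⊓ m)) ⟩
      g l + p l ⊓ m ∸ p l ⊓ m         ≡⟨ cong (_∸ p l ⊓ m) (trans (g+c≡p+t l) (cong (p l +_) tₗ≡0)) ⟩
      p l + 0 ∸ p l ⊓ m               ≡⟨ cong (_∸ p l ⊓ m) (+-identityʳ (p l)) ⟩
      p l ∸ p l ⊓ m                   ≡⟨ m∸[m⊓n]≡m∸n (p l) m ⟩
      p l ∸ m                         ∎
      where open ≡-Reasoning
    -- A move from g must use a stack that t has emptied (else it is a move
    -- from t), and it would take that stack below the bound p l ∸ m.
    g-terminal : Terminal A g
    g-terminal (q , g→q@(move S a _ _)) = t-terminal (removeFrom t S , move S a t-nonEmpty λ _ → refl)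
      where
      t-nonEmpty : ∀ l → l ∈ S → 1 ≤ t l
      t-nonEmpty l l∈S with t l ≟ 0
      ... | no  tₗ≢0 = n≢0⇒n>0 tₗ≢0
      ... | yes tₗ≡0 = contradiction (reachable⇒≥ (p↝g ◅◅ g→q ◅ ε) l)
                         (<⇒≱ (subst (q l <_) (g-at l tₗ≡0) (move⇒< A g→q l∈S)))

lemma3 : (k : ℕ) → (A : ℕ → Set)
       → (∀ ℓ → A ℓ → 1 ≤ ℓ × ℓ ≤ suc k)
       → ∃ A
       → (p : Position (suc k))
       → (∀ i → p i ≤ p (fromℕ k))
       → (m : ℕ)
       → m ≤ p (fromℕ k)
       → Reduced A (ctt p m)
       → (∀ m′ → m < m′ → m′ ≤ p (fromℕ k) → ¬ Reduced A (ctt p m′))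
       → IsR A p (ctt p m)
lemma3 k A sizes _ p p≤pₙ m _ reduced maximal =
  (λ i → p i ∸ m) ,
  (λ i → reduced⇒attained reduced i , λ _ (p↝f , _) → reachable⇒≥ p↝f i) ,
  λ i → m⊓n≡m∸[m∸n] (p i) m
  where open ChopAtMaximalReduced A (λ ℓ a → proj₁ (sizes ℓ a)) p p≤pₙ maximal
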